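{- Let $H=(V_H,E_H)$ be a graph with $V_H=\{v_1,\dots,v_n\}$, and let $G$ be the GP graph obtained from $H$ by adding, for each $i$, new vertices $x_i,y_i,z_i$ and the path $v_i,x_i,y_i,z_i$. Then for every nonnegative integer $k$, $H$ has a dominating set of cardinality at most $k$ if and only if $G$ has a dominating set of cardinality at most $n+k$.
   Context: All graphs are finite and simple. A set $D\subseteq V$ is a dominating set of $G=(V,E)$ if every vertex of $V\setminus D$ has a neighbor in $D$. A GP graph built from $H=(V_H,E_H)$, $V_H=\{v_1,\dots,v_n\}$, has vertex set $V_H\cup\{x_i,y_i,z_i:1\le i\le n\}$ and edge set $E_H\cup\{v_ix_i,x_iy_i,y_iz_i:1\le i\le n\}$. -}

module Defs where

open import Data.Nat using (ℕ; _*_)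
open import Data.Fin using (Fin; zero; suc; remQuot)
open import Data.Fin.Subset using (Subset; _∈_; ∣_∣)
open import Data.Product using (_×_; _,_; ∃-syntax; Σ-syntax)
open import Data.Sum using (_⊎_)
open import Relation.Binary.PropositionalEquality using (_≡_)
open import Relation.Nullary using (¬_)
import Data.Empty
import Data.Nat

record Graph (n : ℕ) : Set₁ where
  field
    Adj   : Fin n → Fin n → Set
    sym   : ∀ {u w} → Adj u w → Adj w u
    irrefl : ∀ {u} → ¬ Adj u u
open Graph public

IsDominating : ∀ {n} → Graph n → Subset n → Set
IsDominating {n} G D = ∀ (u : Fin n) → ¬ (u ∈ D) → ∃[ w ] (w ∈ D × Adj G u w)

HasDomSetOfSize≤ : ∀ {n} → Graph n → ℕ → Set
HasDomSetOfSize≤ G k = Σ[ D ∈ Subset _ ] (IsDominating G D × ∣ D ∣ Data.Nat.≤ k)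

-- Vertices of the GP graph: Fin (4 * n), decoded by remQuot n into (layer , i)
-- with layer 0 = v_i, 1 = x_i, 2 = y_i, 3 = z_i.
-- Adjacency on decoded vertices:
GPAdj' : ∀ {n} → Graph n → Fin 4 × Fin n → Fin 4 × Fin n → Set
GPAdj' H (zero , i) (zero , j) = Adj H i j
GPAdj' H (zero , i) (suc zero , j) = i ≡ j
GPAdj' H (suc zero , i) (zero , j) = i ≡ j
GPAdj' H (suc zero , i) (suc (suc zero) , j) = i ≡ j
GPAdj' H (suc (suc zero) , i) (suc zero , j) = i ≡ j
GPAdj' H (suc (suc zero) , i) (suc (suc (suc zero)) , j) = i ≡ j
GPAdj' H (suc (suc (suc zero)) , i) (suc (suc zero) , j) = i ≡ j
GPAdj' H _ _ = Data.Empty.⊥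

GPAdj : ∀ {n} → Graph n → Fin (4 * n) → Fin (4 * n) → Set
GPAdj {n} H u w = GPAdj' H (remQuot n u) (remQuot n w)

GPAdj'-sym : ∀ {n} (H : Graph n) (a b : Fin 4 × Fin n) → GPAdj' H a b → GPAdj' H b a
GPAdj'-sym H (zero , i) (zero , j) p = sym H p
GPAdj'-sym H (zero , i) (suc zero , j) p = Relation.Binary.PropositionalEquality.sym p
GPAdj'-sym H (suc zero , i) (zero , j) p = Relation.Binary.PropositionalEquality.sym p
GPAdj'-sym H (suc zero , i) (suc (suc zero) , j) p = Relation.Binary.PropositionalEquality.sym p
GPAdj'-sym H (suc (suc zero) , i) (suc zero , j) p = Relation.Binary.PropositionalEquality.sym p
GPAdj'-sym H (suc (suc zero) , i) (suc (suc (suc zero)) , j) p = Relation.Binary.PropositionalEquality.sym p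
GPAdj'-sym H (suc (suc (suc zero)) , i) (suc (suc zero) , j) p = Relation.Binary.PropositionalEquality.sym p

GPAdj'-irrefl : ∀ {n} (H : Graph n) (a : Fin 4 × Fin n) → ¬ GPAdj' H a a
GPAdj'-irrefl H (zero , i) p = irrefl H p
GPAdj'-irrefl H (suc zero , i) ()
GPAdj'-irrefl H (suc (suc zero) , i) ()
GPAdj'-irrefl H (suc (suc (suc zero)) , i) ()

GP : ∀ {n} → Graph n → Graph (4 * n)
GP {n} H = record
  { Adj = GPAdj H
  ; sym = λ {u} {w} → GPAdj'-sym H (remQuot n u) (remQuot n w)
  ; irrefl = λ {u} → GPAdj'-irrefl H (remQuot n u)
  }

-- A dominating set D of H becomes one of G by adding every y_i, which costs exactly n vertices.
-- Conversely, a dominating set of G must contain y_i or z_i for each i (to dominate the leaf z_i),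
-- which accounts for n of its vertices; among the rest, its v_i together with the v_i of each chosen
-- x_i dominate H, since every v_i outside the set is dominated in G by some v_j or by x_i.
module Submission where

open import Defs
open import Data.Nat using (ℕ; _+_)
open import Function.Bundles using (_⇔_)

open import Data.Nat as ℕ using (_≤_; _*_; z≤n; s≤s)
open import Data.Nat.Properties
  using (+-assoc; +-comm; +-identityʳ; +-suc; +-mono-≤; +-monoʳ-≤; +-monoˡ-≤; +-cancelˡ-≤; ≤-trans; ≤-reflexive; module ≤-Reasoning)
open import Data.Fin using (Fin; zero; suc; combine)
open import Data.Fin.Properties using (remQuot-combine; combine-remQuot)
open import Data.Fin.Subset using (Subset; inside; outside; _∈_; _∉_; _∪_; ⊥; ⊤; ∣_∣)
open import Data.Fin.Subset.Properties
  using (_∈?_; ∣⊥∣≡0; ∣⊤∣≡n; ∈⊤; x∈p∪q⁺; p⊆q⇒∣p∣≤∣q∣; ∣p∣≤∣x∷p∣)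
open import Data.Vec using (Vec; []; _∷_; _++_; concat; lookup; map; sum; group)
open import Data.Vec.Properties using (lookup-concat; []=⇒lookup; lookup⇒[]=)
open import Data.Product using (_,_; ∃₂; _×_)
open import Data.Sum using (_⊎_; inj₁; inj₂)
open import Function.Base using (_∘_; id)
open import Function.Bundles using (mk⇔; Equivalence)
open import Relation.Binary.PropositionalEquality as ≡ using (_≡_; refl; trans; cong; cong₂; subst; module ≡-Reasoning)
open import Relation.Nullary using (yes; no; contradiction)

private variable
  m n : ℕ

∣p++q∣≡∣p∣+∣q∣ : (p : Subset m) (q : Subset n) → ∣ p ++ q ∣ ≡ ∣ p ∣ + ∣ q ∣
∣p++q∣≡∣p∣+∣q∣ []            q = refl
∣p++q∣≡∣p∣+∣q∣ (outside ∷ p) q = ∣p++q∣≡∣p∣+∣q∣ p q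
∣p++q∣≡∣p∣+∣q∣ (inside  ∷ p) q = cong ℕ.suc (∣p++q∣≡∣p∣+∣q∣ p q)

∣concat∣≡sum : (ps : Vec (Subset n) m) → ∣ concat ps ∣ ≡ sum (map ∣_∣ ps)
∣concat∣≡sum []       = refl
∣concat∣≡sum (p ∷ ps) = trans (∣p++q∣≡∣p∣+∣q∣ p (concat ps)) (cong (∣ p ∣ +_) (∣concat∣≡sum ps))

∣p∪q∣≤∣p∣+∣q∣ : (p q : Subset n) → ∣ p ∪ q ∣ ≤ ∣ p ∣ + ∣ q ∣
∣p∪q∣≤∣p∣+∣q∣ []            []            = z≤n
∣p∪q∣≤∣p∣+∣q∣ (outside ∷ p) (outside ∷ q) = ∣p∪q∣≤∣p∣+∣q∣ p q
∣p∪q∣≤∣p∣+∣q∣ (outside ∷ p) (inside  ∷ q) =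
  ≤-trans (s≤s (∣p∪q∣≤∣p∣+∣q∣ p q)) (≤-reflexive (≡.sym (+-suc ∣ p ∣ ∣ q ∣)))
∣p∪q∣≤∣p∣+∣q∣ (inside  ∷ p) (t       ∷ q) =
  s≤s (≤-trans (∣p∪q∣≤∣p∣+∣q∣ p q) (+-monoʳ-≤ ∣ p ∣ (∣p∣≤∣x∷p∣ t q)))

cover⇒n≤∣p∣+∣q∣ : (p q : Subset n) → (∀ i → i ∈ p ⊎ i ∈ q) → n ≤ ∣ p ∣ + ∣ q ∣
cover⇒n≤∣p∣+∣q∣ {n} p q cover = begin
  n             ≡⟨ ≡.sym (∣⊤∣≡n n) ⟩
  ∣ ⊤ {n} ∣     ≤⟨ p⊆q⇒∣p∣≤∣q∣ {p = ⊤} (λ {i} _ → x∈p∪q⁺ (cover i)) ⟩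
  ∣ p ∪ q ∣     ≤⟨ ∣p∪q∣≤∣p∣+∣q∣ p q ⟩
  ∣ p ∣ + ∣ q ∣ ∎
  where open ≤-Reasoning

combine-∈⇔ : (ps : Vec (Subset n) m) (l : Fin m) (i : Fin n) → combine l i ∈ concat ps ⇔ i ∈ lookup ps l
combine-∈⇔ ps l i = mk⇔
  (λ i∈ → lookup⇒[]= i (lookup ps l) (trans (≡.sym (lookup-concat ps l i)) ([]=⇒lookup i∈)))
  (λ i∈ → lookup⇒[]= (combine l i) (concat ps) (trans (lookup-concat ps l i) ([]=⇒lookup i∈)))

data Combined (m n : ℕ) : Fin (m * n) → Set where
  combined : (l : Fin m) (i : Fin n) → Combined m n (combine l i)

combined? : (u : Fin (m * n)) → Combined m n u
combined? {m} {n} u = subst (Combined m n) (combine-remQuot {m} n u) (combined _ _)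

pattern layerV = zero
pattern layerX = suc zero
pattern layerY = suc (suc zero)
pattern layerZ = suc (suc (suc zero))

GPAdj-combine : (H : Graph n) (l l′ : Fin 4) (i j : Fin n) →
                GPAdj H (combine l i) (combine l′ j) ≡ GPAdj' H (l , i) (l′ , j)
GPAdj-combine {n} H l l′ i j = cong₂ (GPAdj' H) (remQuot-combine {k = n} l i) (remQuot-combine {k = n} l′ j)

IsDominatingLayers : Graph n → Vec (Subset n) 4 → Set
IsDominatingLayers H ps =
  ∀ l i → i ∉ lookup ps l → ∃₂ λ l′ j → j ∈ lookup ps l′ × GPAdj' H (l , i) (l′ , j)

isDominating-concat⇔ : (H : Graph n) (ps : Vec (Subset n) 4) →
                       IsDominating (GP H) (concat ps) ⇔ IsDominatingLayers H ps
isDominating-concat⇔ {n} H ps = mk⇔ to from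
  where
  to : IsDominating (GP H) (concat ps) → IsDominatingLayers H ps
  to dom l i i∉ with dom (combine l i) (i∉ ∘ Equivalence.to (combine-∈⇔ ps l i))
  ... | w , w∈ , adj with combined? {4} {n} w
  ...   | combined l′ j =
    l′ , j , Equivalence.to (combine-∈⇔ ps l′ j) w∈ , subst id (GPAdj-combine H l l′ i j) adj
  from : IsDominatingLayers H ps → IsDominating (GP H) (concat ps)
  from dom u u∉ with combined? {4} {n} u
  ... | combined l i with dom l i (u∉ ∘ Equivalence.from (combine-∈⇔ ps l i))
  ...   | l′ , j , j∈ , adj =
    combine l′ j , Equivalence.from (combine-∈⇔ ps l′ j) j∈ , subst id (≡.sym (GPAdj-combine H l l′ i j)) adj

pathLayers : Subset n → Vec (Subset n) 4
pathLayers D = D ∷ ⊥ ∷ ⊤ ∷ ⊥ ∷ []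

isDominatingLayers-path : (H : Graph n) (D : Subset n) → IsDominating H D → IsDominatingLayers H (pathLayers D)
isDominatingLayers-path H D dom layerV i i∉ with dom i i∉
... | j , j∈ , adj = layerV , j , j∈ , adj
isDominatingLayers-path H D dom layerX i _   = layerY , i , ∈⊤ , refl
isDominatingLayers-path H D dom layerY i i∉ = contradiction ∈⊤ i∉
isDominatingLayers-path H D dom layerZ i _   = layerY , i , ∈⊤ , refl

∣concat-pathLayers∣ : (D : Subset n) → ∣ concat (pathLayers D) ∣ ≡ ∣ D ∣ + n
∣concat-pathLayers∣ {n} D = begin
  ∣ concat (pathLayers D) ∣                          ≡⟨ ∣concat∣≡sum (pathLayers D) ⟩
  ∣ D ∣ + (∣ ⊥ {n} ∣ + (∣ ⊤ {n} ∣ + (∣ ⊥ {n} ∣ + 0))) ≡⟨ cong (λ k → ∣ D ∣ + (k + (∣ ⊤ {n} ∣ + (k + 0)))) (∣⊥∣≡0 n) ⟩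
  ∣ D ∣ + (∣ ⊤ {n} ∣ + 0)                            ≡⟨ cong (∣ D ∣ +_) (+-identityʳ ∣ ⊤ {n} ∣) ⟩
  ∣ D ∣ + ∣ ⊤ {n} ∣                                  ≡⟨ cong (∣ D ∣ +_) (∣⊤∣≡n n) ⟩
  ∣ D ∣ + n                                          ∎
  where open ≡-Reasoning

module _ (H : Graph n) (a b c d : Subset n) (dom : IsDominatingLayers H (a ∷ b ∷ c ∷ d ∷ [])) where

  isDominating-∪ : IsDominating H (a ∪ b)
  isDominating-∪ i i∉ with dom layerV i (i∉ ∘ x∈p∪q⁺ ∘ inj₁)
  ... | layerV , j , j∈ , adj  = j , x∈p∪q⁺ (inj₁ j∈) , adj
  ... | layerX , j , j∈ , refl = contradiction (x∈p∪q⁺ (inj₂ j∈)) i∉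

  ∈c⊎∈d : ∀ i → i ∈ c ⊎ i ∈ d
  ∈c⊎∈d i with i ∈? d
  ... | yes i∈ = inj₂ i∈
  ... | no  i∉ with dom layerZ i i∉
  ...   | layerY , j , j∈ , refl = inj₁ j∈

  ∣∪∣+n≤∣concat∣ : ∣ a ∪ b ∣ + n ≤ ∣ concat (a ∷ b ∷ c ∷ d ∷ []) ∣
  ∣∪∣+n≤∣concat∣ = begin
    ∣ a ∪ b ∣ + n                             ≤⟨ +-mono-≤ (∣p∪q∣≤∣p∣+∣q∣ a b) (cover⇒n≤∣p∣+∣q∣ c d ∈c⊎∈d) ⟩
    (∣ a ∣ + ∣ b ∣) + (∣ c ∣ + ∣ d ∣)         ≡⟨ +-assoc ∣ a ∣ ∣ b ∣ _ ⟩
    ∣ a ∣ + (∣ b ∣ + (∣ c ∣ + ∣ d ∣))         ≡⟨ cong (λ k → ∣ a ∣ + (∣ b ∣ + (∣ c ∣ + k))) (≡.sym (+-identityʳ ∣ d ∣)) ⟩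
    ∣ a ∣ + (∣ b ∣ + (∣ c ∣ + (∣ d ∣ + 0)))   ≡⟨ ≡.sym (∣concat∣≡sum (a ∷ b ∷ c ∷ d ∷ [])) ⟩
    ∣ concat (a ∷ b ∷ c ∷ d ∷ []) ∣           ∎
    where open ≤-Reasoning

lemma4p1 : ∀ {n} (H : Graph n) (k : ℕ) → HasDomSetOfSize≤ H k ⇔ HasDomSetOfSize≤ (GP H) (n + k)
lemma4p1 {n} H k = mk⇔ to from
  where
  open ≤-Reasoning
  to : HasDomSetOfSize≤ H k → HasDomSetOfSize≤ (GP H) (n + k)
  to (D , dom , ∣D∣≤k) =
    concat (pathLayers D) ,
    Equivalence.from (isDominating-concat⇔ H (pathLayers D)) (isDominatingLayers-path H D dom) ,
    (begin
      ∣ concat (pathLayers D) ∣ ≡⟨ ∣concat-pathLayers∣ D ⟩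
      ∣ D ∣ + n                 ≤⟨ +-monoˡ-≤ n ∣D∣≤k ⟩
      k + n                     ≡⟨ +-comm k n ⟩
      n + k                     ∎)
  from : HasDomSetOfSize≤ (GP H) (n + k) → HasDomSetOfSize≤ H k
  from (D′ , dom , ∣D′∣≤n+k) with group 4 n D′
  ... | a ∷ b ∷ c ∷ d ∷ [] , refl =
    a ∪ b ,
    isDominating-∪ H a b c d layers ,
    +-cancelˡ-≤ n _ _ (begin
      n + ∣ a ∪ b ∣                 ≡⟨ +-comm n _ ⟩
      ∣ a ∪ b ∣ + n                 ≤⟨ ∣∪∣+n≤∣concat∣ H a b c d layers ⟩
      ∣ concat (a ∷ b ∷ c ∷ d ∷ []) ∣ ≤⟨ ∣D′∣≤n+k ⟩
      n + k                         ∎)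
    where
    layers : IsDominatingLayers H (a ∷ b ∷ c ∷ d ∷ [])
    layers = Equivalence.to (isDominating-concat⇔ H (a ∷ b ∷ c ∷ d ∷ [])) dom
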